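{- Let $G$ be a connected vertex-transitive graph. Then all of its vertex residuals are isomorphic, i.e.\ $Res(G,\langle\{u\}\rangle)\cong Res(G,\langle\{v\}\rangle)$ for all $u,v\in V(G)$. Moreover, the converse fails even for regular graphs: there exists a connected regular graph which is not vertex-transitive but all of whose vertex residuals are isomorphic.
   Context: For a connected finite graph $G$ and a nonempty set $V_0\subseteq V(G)$, let $V_i$ be the set of vertices at distance exactly $i$ from $V_0$, and let $r$ be the largest $i$ with $V_i\neq\emptyset$. The root is $R_G=\langle V_0\rangle$ (induced subgraph) and the distance-residual graph is $Res(G,R_G)=\langle V_r\rangle$. A vertex residual is $Res(G,\langle\{u\}\rangle)$ for a single vertex $u$. -}

module Defs where

open import Data.Nat using (ℕ; zero; suc; _≤_; _<_)
open import Data.Fin using (Fin)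
open import Data.Bool using (Bool; true; false; T)
open import Data.List using (length; filter)
open import Data.Product using (Σ; ∃; ∃-syntax; _×_; _,_)
open import Relation.Nullary using (¬_)
open import Relation.Binary.PropositionalEquality using (_≡_)
open import Function.Bundles using (_↔_; _⇔_; Inverse)
open import Data.Bool.Properties using (T?)
import Data.List as L

record Graph (n : ℕ) : Set where
  field
    adj   : Fin n → Fin n → Bool
    sym   : ∀ u v → adj u v ≡ adj v u
    loopless : ∀ u → adj u u ≡ false

module _ {n : ℕ} (G : Graph n) where
  open Graph G

  Adj : Fin n → Fin n → Set
  Adj u v = T (adj u v)

  data Walk : ℕ → Fin n → Fin n → Set where
    here : ∀ {u} → Walk zero u u
    step : ∀ {k u v w} → Adj u v → Walk k v w → Walk (suc k) u w

  Dist : Fin n → Fin n → ℕ → Set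
  Dist u v k = Walk k u v × (∀ j → j < k → ¬ Walk j u v)

  Connected : Set
  Connected = ∀ u v → ∃[ k ] Walk k u v

  degree : Fin n → ℕ
  degree v = length (filter (λ w → T? (adj v w)) (L.allFin n))

  Regular : Set
  Regular = ∃[ d ] (∀ v → degree v ≡ d)

  IsAutomorphism : (Fin n ↔ Fin n) → Set
  IsAutomorphism σ = ∀ u v → adj u v ≡ adj (Inverse.to σ u) (Inverse.to σ v)

  VertexTransitive : Set
  VertexTransitive = ∀ u v → Σ (Fin n ↔ Fin n) λ σ → IsAutomorphism σ × Inverse.to σ u ≡ v

  -- V_r for root V_0 = {u}: vertices whose distance from u is maximal
  -- (r = eccentricity of u; every vertex has a distance since G is assumed connected)
  InResidual : Fin n → Fin n → Set
  InResidual u v = ∃[ r ] (Dist u v r × (∀ w k → Dist u w k → k ≤ r))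

InducedIso : ∀ {n m} (G : Graph n) (P : Fin n → Set) (H : Graph m) (Q : Fin m → Set) → Set
InducedIso {n} {m} G P H Q =
  Σ (Fin n → Fin m) λ f → Σ (Fin m → Fin n) λ g →
    (∀ x → P x → Q (f x)) × (∀ y → Q y → P (g y)) ×
    (∀ x → P x → g (f x) ≡ x) × (∀ y → Q y → f (g y) ≡ y) ×
    (∀ x y → P x → P y → Graph.adj G x y ≡ Graph.adj H (f x) (f y))

ResidualsIso : ∀ {n} (G : Graph n) (u v : Fin n) → Set
ResidualsIso G u v = InducedIso G (InResidual G u) G (InResidual G v)

AllVertexResidualsIso : ∀ {n} (G : Graph n) → Set
AllVertexResidualsIso {n} G = ∀ (u v : Fin n) → ResidualsIso G u v

-- An automorphism carrying u to v preserves walks and hence distances, so it maps the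
-- vertices at maximal distance from u onto those at maximal distance from v.
-- The converse fails for the complement of C₄ ∪ C₅: it is 6-regular of diameter 2, so the
-- residual of a vertex consists of its two neighbours on its own cycle, which are
-- non-adjacent in C₄ ∪ C₅ and hence always induce K₂. Opposite vertices of the C₄ are twins
-- (same neighbours apart from each other) while no vertex of the C₅ has a twin, and
-- automorphisms preserve twins, so none carries a vertex of the C₄ to one of the C₅.
module Submission where

open import Defs
open import Data.Nat as ℕ using (ℕ; zero; suc; _≤_; _<_; z≤n; s≤s)
open import Data.Nat.Properties using (≤-refl; ≤-trans; ≮⇒≥; ≤-<-trans)
open import Data.Fin using (Fin; #_; _≟_)
open import Data.Fin.Properties using (all?; any?)
open import Data.Vec using (_∷_; []; lookup)
open import Data.Bool using (Bool; true; false; T; not; _∨_; if_then_else_)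
open import Data.Bool.Properties as Bool using (T?)
open import Data.Product using (Σ; _×_; _,_; ∃-syntax)
open import Data.Sum using (_⊎_; inj₁; inj₂)
open import Function using (_∘_)
open import Function.Bundles using (_↔_; Inverse; Injection)
open import Function.Properties.Inverse using (↔⇒↣)
open import Relation.Nullary using (¬_; Dec; does; contradiction)
open import Relation.Nullary.Decidable
  using (toWitness; toWitnessFalse; ¬?; _×-dec_; _⊎-dec_; _→-dec_; dec-true; dec-false)
open import Relation.Binary.PropositionalEquality
  using (_≡_; _≢_; refl; sym; trans; cong; cong₂; subst; subst₂; module ≡-Reasoning)

walk-map : ∀ {n m} {G : Graph n} {H : Graph m} (h : Fin n → Fin m) →
           (∀ {x y} → Adj G x y → Adj H (h x) (h y)) →
           ∀ {k x y} → Walk G k x y → Walk H k (h x) (h y)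
walk-map h hom here       = here
walk-map h hom (step p w) = step (hom p) (walk-map h hom w)

module _ {n : ℕ} (G : Graph n) where
  open Graph G using (adj)

  Twins : Fin n → Fin n → Set
  Twins u w = ∀ x → x ≡ u ⊎ x ≡ w ⊎ adj u x ≡ adj w x

  HasTwin : Fin n → Set
  HasTwin u = ∃[ w ] (w ≢ u × Twins u w)

  hasTwin? : ∀ u → Dec (HasTwin u)
  hasTwin? u = any? λ w → ¬? (w ≟ u) ×-dec all? λ x →
    (x ≟ u) ⊎-dec (x ≟ w) ⊎-dec (adj u x Bool.≟ adj w x)

module Automorphism {n : ℕ} {G : Graph n} {σ : Fin n ↔ Fin n} (aut : IsAutomorphism G σ) where
  open Graph G using (adj)
  open Inverse σ using (to; from; strictlyInverseˡ; strictlyInverseʳ)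

  to-hom : ∀ {x y} → Adj G x y → Adj G (to x) (to y)
  to-hom {x} {y} = subst T (aut x y)

  from-hom : ∀ {x y} → Adj G x y → Adj G (from x) (from y)
  from-hom {x} {y} = subst T (sym (trans (aut (from x) (from y))
                                         (cong₂ adj (strictlyInverseˡ x) (strictlyInverseˡ y))))

  walk-preserved : ∀ {k x y} → Walk G k x y → Walk G k (to x) (to y)
  walk-preserved = walk-map to to-hom

  walk-reflected : ∀ {k x y} → Walk G k (to x) (to y) → Walk G k x y
  walk-reflected {x = x} {y} w =
    subst₂ (Walk G _) (strictlyInverseʳ x) (strictlyInverseʳ y) (walk-map from from-hom w)

  dist-preserved : ∀ {k x y} → Dist G x y k → Dist G (to x) (to y) k
  dist-preserved (w , shortest) = walk-preserved w , λ j j<k w′ → shortest j j<k (walk-reflected w′)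

  dist-reflected : ∀ {k x y} → Dist G (to x) (to y) k → Dist G x y k
  dist-reflected (w , shortest) = walk-reflected w , λ j j<k w′ → shortest j j<k (walk-preserved w′)

  residual-preserved : ∀ {u x} → InResidual G u x → InResidual G (to u) (to x)
  residual-preserved {u} (r , d , maximal) = r , dist-preserved d , λ w k d′ →
    maximal (from w) k (dist-reflected (subst (λ z → Dist G (to u) z k) (sym (strictlyInverseˡ w)) d′))

  residual-reflected : ∀ {u x} → InResidual G (to u) (to x) → InResidual G u x
  residual-reflected (r , d , maximal) = r , dist-reflected d , λ w k d′ →
    maximal (to w) k (dist-preserved d′)

  residualsIso : ∀ u → ResidualsIso G u (to u)
  residualsIso u =
    to , from ,
    (λ _ → residual-preserved) ,
    (λ y py → residual-reflected (subst (InResidual G (to u)) (sym (strictlyInverseˡ y)) py)) ,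
    (λ x _ → strictlyInverseʳ x) ,
    (λ y _ → strictlyInverseˡ y) ,
    (λ x y _ _ → aut x y)

  twins-preserved : ∀ {u w} → Twins G u w → Twins G (to u) (to w)
  twins-preserved {u} {w} twins x with twins (from x)
  ... | inj₁ refl        = inj₁ (sym (strictlyInverseˡ x))
  ... | inj₂ (inj₁ refl) = inj₂ (inj₁ (sym (strictlyInverseˡ x)))
  ... | inj₂ (inj₂ same) = inj₂ (inj₂ (begin
    adj (to u) x             ≡⟨ cong (adj (to u)) (sym (strictlyInverseˡ x)) ⟩
    adj (to u) (to (from x)) ≡⟨ sym (aut u (from x)) ⟩
    adj u (from x)           ≡⟨ same ⟩
    adj w (from x)           ≡⟨ aut w (from x) ⟩
    adj (to w) (to (from x)) ≡⟨ cong (adj (to w)) (strictlyInverseˡ x) ⟩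
    adj (to w) x             ∎))
    where open ≡-Reasoning

  hasTwin-preserved : ∀ {u} → HasTwin G u → HasTwin G (to u)
  hasTwin-preserved (w , w≢u , twins) =
    to w , w≢u ∘ Injection.injective (↔⇒↣ σ) , twins-preserved twins

vertexTransitive⇒allVertexResidualsIso : ∀ {n} {G : Graph n} →
  VertexTransitive G → AllVertexResidualsIso G
vertexTransitive⇒allVertexResidualsIso {G = G} vt u v with vt u v
... | σ , aut , refl = Automorphism.residualsIso {G = G} {σ} aut u

vertexTransitive⇒hasTwin-invariant : ∀ {n} {G : Graph n} → VertexTransitive G →
  ∀ u v → HasTwin G u → HasTwin G v
vertexTransitive⇒hasTwin-invariant {G = G} vt u v with vt u v
... | σ , aut , refl = Automorphism.hasTwin-preserved {G = G} {σ} aut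

module _ {n : ℕ} (G : Graph n) where

  Diameter≤2 : Set
  Diameter≤2 = ∀ u w → w ≡ u ⊎ Adj G u w ⊎ ∃[ m ] (Adj G u m × Adj G m w)

  NonNeighbour : Fin n → Fin n → Set
  NonNeighbour u x = x ≢ u × ¬ Adj G u x

  nonNeighbour? : ∀ u x → Dec (NonNeighbour u x)
  nonNeighbour? u x = ¬? (x ≟ u) ×-dec ¬? (T? (Graph.adj G u x))

module _ {n : ℕ} {G : Graph n} (diam : Diameter≤2 G) where

  diameter≤2⇒walk≤2 : ∀ u w → ∃[ j ] (j ≤ 2 × Walk G j u w)
  diameter≤2⇒walk≤2 u w with diam u w
  ... | inj₁ refl               = 0 , z≤n , here
  ... | inj₂ (inj₁ p)           = 1 , s≤s z≤n , step p here
  ... | inj₂ (inj₂ (m , p , q)) = 2 , ≤-refl , step p (step q here)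

  diameter≤2⇒connected : Connected G
  diameter≤2⇒connected u w with diameter≤2⇒walk≤2 u w
  ... | j , _ , walk = j , walk

  diameter≤2⇒dist≤2 : ∀ {u w k} → Dist G u w k → k ≤ 2
  diameter≤2⇒dist≤2 {u} {w} (_ , shortest) with diameter≤2⇒walk≤2 u w
  ... | j , j≤2 , walk = ≮⇒≥ (λ 2<k → shortest j (≤-<-trans j≤2 2<k) walk)

  nonNeighbour⇒dist2 : ∀ {u x} → NonNeighbour G u x → Dist G u x 2
  nonNeighbour⇒dist2 {u} {x} (x≢u , ¬adj) = walk , shorter
    where
      walk : Walk G 2 u x
      walk with diam u x
      ... | inj₁ x≡u                = contradiction x≡u x≢u
      ... | inj₂ (inj₁ p)           = contradiction p ¬adj
      ... | inj₂ (inj₂ (m , p , q)) = step p (step q here)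
      shorter : ∀ j → j < 2 → ¬ Walk G j u x
      shorter zero          _              here          = x≢u refl
      shorter (suc zero)    _              (step p here) = ¬adj p
      shorter (suc (suc j)) (s≤s (s≤s ())) _

  nonNeighbour⇒residual : ∀ {u x} → NonNeighbour G u x → InResidual G u x
  nonNeighbour⇒residual nn = 2 , nonNeighbour⇒dist2 nn , λ _ _ → diameter≤2⇒dist≤2

  residual⇒nonNeighbour : ∀ {u x y} → NonNeighbour G u x → InResidual G u y → NonNeighbour G u y
  residual⇒nonNeighbour {x = x} nn (r , (_ , shortest) , maximal) =
    (λ { refl → shortest 0 (≤-trans (s≤s z≤n) 2≤r) here }) ,
    (λ p → shortest 1 2≤r (step p here))
    where
      2≤r : 2 ≤ r
      2≤r = maximal x 2 (nonNeighbour⇒dist2 nn)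

record IsPair {n : ℕ} (P : Fin n → Set) (a b : Fin n) : Set where
  field
    distinct : a ≢ b
    fst∈     : P a
    snd∈     : P b
    covers   : ∀ x → P x → x ≡ a ⊎ x ≡ b

  elim : (R : Fin n → Set) → R a → R b → ∀ x → P x → R x
  elim R ra rb x px with covers x px
  ... | inj₁ refl = ra
  ... | inj₂ refl = rb

module _ {n m : ℕ} where

  choose : Fin n → Fin m → Fin m → Fin n → Fin m
  choose a c d x = if does (x ≟ a) then c else d

  choose-fst : ∀ a c d → choose a c d a ≡ c
  choose-fst a c d rewrite dec-true (a ≟ a) refl = refl

  choose-snd : ∀ {a b} c d → b ≢ a → choose a c d b ≡ d
  choose-snd {a} {b} c d b≢a rewrite dec-false (b ≟ a) b≢a = refl

pair-InducedIso : ∀ {n m} {G : Graph n} {H : Graph m} {P Q a b c d} →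
  IsPair P a b → IsPair Q c d → Graph.adj G a b ≡ Graph.adj H c d → InducedIso G P H Q
pair-InducedIso {n} {m} {G} {H} {P} {Q} {a} {b} {c} {d} Pab Qcd ab≡cd =
  f , g ,
  P.elim (Q ∘ f) (subst Q (sym fa) Q.fst∈) (subst Q (sym fb) Q.snd∈) ,
  Q.elim (P ∘ g) (subst P (sym gc) P.fst∈) (subst P (sym gd) P.snd∈) ,
  P.elim (λ x → g (f x) ≡ x) (trans (cong g fa) gc) (trans (cong g fb) gd) ,
  Q.elim (λ y → f (g y) ≡ y) (trans (cong f gc) fa) (trans (cong f gd) fb) ,
  adj-preserved
  where
    module P = IsPair Pab
    module Q = IsPair Qcd
    open Graph using (adj; loopless)

    f : Fin n → Fin m
    f = choose a c d
    g : Fin m → Fin n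
    g = choose c a b
    fa : f a ≡ c
    fa = choose-fst a c d
    fb : f b ≡ d
    fb = choose-snd c d (P.distinct ∘ sym)
    gc : g c ≡ a
    gc = choose-fst c a b
    gd : g d ≡ b
    gd = choose-snd a b (Q.distinct ∘ sym)

    Preserved : Fin n → Fin n → Set
    Preserved x y = adj G x y ≡ adj H (f x) (f y)

    diagonal : ∀ x → Preserved x x
    diagonal x = trans (loopless G x) (sym (loopless H (f x)))

    flipped : ∀ {x y} → Preserved x y → Preserved y x
    flipped {x} {y} e = trans (Graph.sym G y x) (trans e (Graph.sym H (f x) (f y)))

    edge : Preserved a b
    edge = trans ab≡cd (sym (cong₂ (adj H) fa fb))

    adj-preserved : ∀ x y → P x → P y → Preserved x y
    adj-preserved x y px py = P.elim (λ x → Preserved x y)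
      (P.elim (Preserved a) (diagonal a) edge y py)
      (P.elim (Preserved b) (flipped edge) (diagonal b) y py)
      x px

-- The cycles of the permutation `next` are 0→1→2→3→0 and 4→5→6→7→8→4, i.e. C₄ ∪ C₅.
next prev : Fin 9 → Fin 9
next = lookup (# 1 ∷ # 2 ∷ # 3 ∷ # 0 ∷ # 5 ∷ # 6 ∷ # 7 ∷ # 8 ∷ # 4 ∷ [])
prev = lookup (# 3 ∷ # 0 ∷ # 1 ∷ # 2 ∷ # 8 ∷ # 4 ∷ # 5 ∷ # 6 ∷ # 7 ∷ [])

co-C₄∪C₅ : Graph 9
co-C₄∪C₅ = record { adj = adj ; sym = adj-sym ; loopless = adj-loopless }
  where
    adj : Fin 9 → Fin 9 → Bool
    adj x y = not (does (x ≟ y) ∨ does (y ≟ next x) ∨ does (x ≟ next y))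
    adj-sym : ∀ x y → adj x y ≡ adj y x
    adj-sym = toWitness {a? = all? λ x → all? λ y → adj x y Bool.≟ adj y x} _
    adj-loopless : ∀ x → adj x x ≡ false
    adj-loopless = toWitness {a? = all? λ x → adj x x Bool.≟ false} _

module _ where
  open Graph co-C₄∪C₅ using (adj)

  co-C₄∪C₅-diameter≤2 : Diameter≤2 co-C₄∪C₅
  co-C₄∪C₅-diameter≤2 = toWitness {a? = all? λ u → all? λ w →
    (w ≟ u) ⊎-dec T? (adj u w) ⊎-dec any? (λ m → T? (adj u m) ×-dec T? (adj m w))} _

  co-C₄∪C₅-regular : Regular co-C₄∪C₅
  co-C₄∪C₅-regular = 6 , toWitness {a? = all? λ v → degree co-C₄∪C₅ v ℕ.≟ 6} _

  residual-isPair : ∀ u → IsPair (InResidual co-C₄∪C₅ u) (next u) (prev u)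
  residual-isPair u = record
    { distinct = toWitness {a? = all? λ u → ¬? (next u ≟ prev u)} _ u
    ; fst∈     = nonNeighbour⇒residual co-C₄∪C₅-diameter≤2 (next-nonNeighbour u)
    ; snd∈     = nonNeighbour⇒residual co-C₄∪C₅-diameter≤2 (prev-nonNeighbour u)
    ; covers   = λ x → nonNeighbours⊆ u x
                     ∘ residual⇒nonNeighbour co-C₄∪C₅-diameter≤2 (next-nonNeighbour u)
    }
    where
      next-nonNeighbour : ∀ u → NonNeighbour co-C₄∪C₅ u (next u)
      next-nonNeighbour = toWitness {a? = all? λ u → nonNeighbour? co-C₄∪C₅ u (next u)} _
      prev-nonNeighbour : ∀ u → NonNeighbour co-C₄∪C₅ u (prev u)
      prev-nonNeighbour = toWitness {a? = all? λ u → nonNeighbour? co-C₄∪C₅ u (prev u)} _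
      nonNeighbours⊆ : ∀ u x → NonNeighbour co-C₄∪C₅ u x → x ≡ next u ⊎ x ≡ prev u
      nonNeighbours⊆ = toWitness {a? = all? λ u → all? λ x →
        nonNeighbour? co-C₄∪C₅ u x →-dec ((x ≟ next u) ⊎-dec (x ≟ prev u))} _

  co-C₄∪C₅-allVertexResidualsIso : AllVertexResidualsIso co-C₄∪C₅
  co-C₄∪C₅-allVertexResidualsIso u v =
    pair-InducedIso {G = co-C₄∪C₅} {H = co-C₄∪C₅} (residual-isPair u) (residual-isPair v)
      (trans (edge u) (sym (edge v)))
    where
      edge : ∀ u → adj (next u) (prev u) ≡ true
      edge = toWitness {a? = all? λ u → adj (next u) (prev u) Bool.≟ true} _

  co-C₄∪C₅-not-vertexTransitive : ¬ VertexTransitive co-C₄∪C₅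
  co-C₄∪C₅-not-vertexTransitive vt =
    toWitnessFalse {a? = hasTwin? co-C₄∪C₅ (# 4)} _
      (vertexTransitive⇒hasTwin-invariant {G = co-C₄∪C₅} vt (# 0) (# 4)
        (toWitness {a? = hasTwin? co-C₄∪C₅ (# 0)} _))

lemma1 : (∀ (n : ℕ) (G : Graph n) → Connected G → VertexTransitive G → AllVertexResidualsIso G)
    × Σ ℕ (λ n → Σ (Graph n) λ G →
        Connected G × Regular G × ¬ VertexTransitive G × AllVertexResidualsIso G)
lemma1 =
  (λ _ _ _ → vertexTransitive⇒allVertexResidualsIso) ,
  9 , co-C₄∪C₅ ,
  diameter≤2⇒connected co-C₄∪C₅-diameter≤2 ,
  co-C₄∪C₅-regular ,
  co-C₄∪C₅-not-vertexTransitive ,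
  co-C₄∪C₅-allVertexResidualsIso
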